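{- Let $\mathbf L=(L,\vee,\wedge,0,1)$ be a complemented lattice and $a,b,c\in L$. Then: (i) $0\odot a=a\odot0=\{0\}$; (ii) $1\odot a=a\odot1=\{a\}$; (iii) $a\wedge b\le a\odot b\le b$, and if $b\le a$ then $a\odot b=\{b\}$; (iv) if $a\le b$ then $a\odot c\le_i b\odot c$ for $i=1,2$; (v) if $\mathbf L$ is modular, then $a\le b$ if and only if $a\odot b=\{a\}$, and moreover $(a\odot b)\odot b=a\odot b$.
   Context: A bounded lattice is complemented if every element $a$ has some $b$ with $a\vee b=1$, $a\wedge b=0$ (complements need not be unique); lattices are non-trivial. For $b\in L$, $b^+:=\{x\in L\mid b\vee x=1,\ b\wedge x=0\}$. For $A,B\subseteq L$: $A\vee B:=\{x\vee y\mid x\in A,y\in B\}$, $A\wedge B:=\{x\wedge y\mid x\in A,y\in B\}$; $A\le B$ means $x\le y$ for all $x\in A,y\in B$; $A\le_1B$ means for every $x\in A$ there is $y\in B$ with $x\le y$; $A\le_2B$ means for every $y\in B$ there is $x\in A$ with $x\le y$; singletons are identified with elements. Define $a\odot b:=b\wedge(a\vee b^+)=\{b\wedge(a\vee x)\mid x\in b^+\}$ and, for $A,B\subseteq L$, $A\odot B:=B\wedge(A\vee B^+)$ where $B^+:=\{x\in L\mid y\vee x=1,\ y\wedge x=0\text{ for all }y\in B\}$. -}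

module Defs where

open import Level using (Level; _⊔_; Lift)
open import Data.Product using (Σ; ∃; ∃-syntax; _×_; _,_)
open import Relation.Nullary using (¬_)
open import Relation.Binary.Lattice using (BoundedLattice)

module Ops {c ℓ₁ ℓ₂ : Level} (L : BoundedLattice c ℓ₁ ℓ₂) where
  open BoundedLattice L

  NonTrivial : Set ℓ₁
  NonTrivial = ¬ (⊤ ≈ ⊥)

  IsComplementOf : Carrier → Carrier → Set ℓ₁
  IsComplementOf a x = (a ∨ x ≈ ⊤) × (a ∧ x ≈ ⊥)

  Complemented : Set (c ⊔ ℓ₁)
  Complemented = ∀ a → ∃[ b ] IsComplementOf a b

  Modular : Set (c ⊔ ℓ₁ ⊔ ℓ₂)
  Modular = ∀ x y z → x ≤ z → x ∨ (y ∧ z) ≈ (x ∨ y) ∧ z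

  Subset : Set (Level.suc (c ⊔ ℓ₁))
  Subset = Carrier → Set (c ⊔ ℓ₁)

  ｛_｝ : Carrier → Subset
  ｛ a ｝ x = Lift c (x ≈ a)

  _⁺ : Carrier → Subset
  (b ⁺) x = Lift c (IsComplementOf b x)

  _⁺ˢ : Subset → Subset
  (B ⁺ˢ) x = ∀ y → B y → IsComplementOf y x

  _∨ˢ_ : Subset → Subset → Subset
  (A ∨ˢ B) z = ∃[ x ] ∃[ y ] (A x × B y × z ≈ x ∨ y)

  _∧ˢ_ : Subset → Subset → Subset
  (A ∧ˢ B) z = ∃[ x ] ∃[ y ] (A x × B y × z ≈ x ∧ y)

  -- a ⊙ b := b ∧ (a ∨ b⁺) = { b ∧ (a ∨ x) | x ∈ b⁺ }
  _⊙_ : Carrier → Carrier → Subset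
  (a ⊙ b) z = ∃[ x ] ((b ⁺) x × z ≈ b ∧ (a ∨ x))

  _⊙ˢ_ : Subset → Subset → Subset
  A ⊙ˢ B = B ∧ˢ (A ∨ˢ (B ⁺ˢ))

  _≐_ : Subset → Subset → Set (c ⊔ ℓ₁)
  A ≐ B = ∀ x → (A x → B x) × (B x → A x)

  _≤ˢ_ : Subset → Subset → Set (c ⊔ ℓ₁ ⊔ ℓ₂)
  A ≤ˢ B = ∀ x y → A x → B y → x ≤ y

  _≤₁_ : Subset → Subset → Set (c ⊔ ℓ₁ ⊔ ℓ₂)
  A ≤₁ B = ∀ x → A x → ∃[ y ] (B y × x ≤ y)

  _≤₂_ : Subset → Subset → Set (c ⊔ ℓ₁ ⊔ ℓ₂)
  A ≤₂ B = ∀ y → B y → ∃[ x ] (A x × x ≤ y)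

-- Most clauses concern the elements b ∧ (a ∨ x) for complements x of b: as complements exist,
-- a ⊙ b is the singleton ｛ w ｝ as soon as all of them equal w.  In a modular lattice
-- u ≤ b gives b ∧ (u ∨ x) ≈ u ∨ (x ∧ b) ≈ u, so u ⊙ b ≐ ｛ u ｝ for every u ≤ b; since
-- (a ⊙ b) ⊙ˢ ｛ b ｝ is the union of the sets u ⊙ b over u ∈ a ⊙ b, all below b, it is a ⊙ b.
module Submission where

open import Defs
open import Level using (Level; lift; lower)
open import Data.Product using (_×_; _,_; proj₁; proj₂; ∃-syntax)
open import Function using (_⇔_; mk⇔)
open import Relation.Binary.Lattice using (BoundedLattice)
import Relation.Binary.Lattice.Properties.MeetSemilattice as MeetProperties
import Relation.Binary.Lattice.Properties.JoinSemilattice as JoinProperties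
import Relation.Binary.Lattice.Properties.BoundedLattice as BoundedProperties
import Relation.Binary.Reasoning.Setoid as SetoidReasoning

module ComplementedLatticeProperties {c ℓ₁ ℓ₂ : Level} (L : BoundedLattice c ℓ₁ ℓ₂) where
  open BoundedLattice L
  open Ops L
  open MeetProperties meetSemilattice using (∧-comm; ∧-cong; ∧-monotonic; y≤x⇒x∧y≈y)
  open JoinProperties joinSemilattice using (∨-comm; ∨-cong; ∨-monotonic; x≤y⇒x∨y≈y)
  open BoundedProperties L using (∧-zeroˡ)
  open SetoidReasoning setoid

  x≤y⇒x∧y≈x : ∀ {x y} → x ≤ y → x ∧ y ≈ x
  x≤y⇒x∧y≈x {x} {y} x≤y = Eq.trans (∧-comm x y) (y≤x⇒x∧y≈y x≤y)

  ⊥-identityˡ : ∀ x → ⊥ ∨ x ≈ x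
  ⊥-identityˡ x = x≤y⇒x∨y≈y (minimum x)

  ⊥-identityʳ : ∀ x → x ∨ ⊥ ≈ x
  ⊥-identityʳ x = Eq.trans (∨-comm x ⊥) (⊥-identityˡ x)

  ⊤-identityˡ : ∀ x → ⊤ ∧ x ≈ x
  ⊤-identityˡ x = y≤x⇒x∧y≈y (maximum x)

  IsComplementOf-respˡ : ∀ {a a′ x} → a ≈ a′ → IsComplementOf a x → IsComplementOf a′ x
  IsComplementOf-respˡ a≈a′ (a∨x≈⊤ , a∧x≈⊥) =
    Eq.trans (∨-cong (Eq.sym a≈a′) Eq.refl) a∨x≈⊤ , Eq.trans (∧-cong (Eq.sym a≈a′) Eq.refl) a∧x≈⊥

  complement-of-⊤ : ∀ {x} → IsComplementOf ⊤ x → x ≈ ⊥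
  complement-of-⊤ {x} (_ , ⊤∧x≈⊥) = Eq.trans (Eq.sym (⊤-identityˡ x)) ⊤∧x≈⊥

  complement⇒｛｝⁺ˢ : ∀ {b x} → IsComplementOf b x → (｛ b ｝ ⁺ˢ) x
  complement⇒｛｝⁺ˢ x∈b⁺ y (lift y≈b) = IsComplementOf-respˡ (Eq.sym y≈b) x∈b⁺

  modular-complement-cancel : Modular → ∀ {u b x} → u ≤ b → IsComplementOf b x → b ∧ (u ∨ x) ≈ u
  modular-complement-cancel modular {u} {b} {x} u≤b (_ , b∧x≈⊥) = begin
    b ∧ (u ∨ x)   ≈⟨ ∧-comm b (u ∨ x) ⟩
    (u ∨ x) ∧ b   ≈⟨ modular u x b u≤b ⟨
    u ∨ (x ∧ b)   ≈⟨ ∨-cong Eq.refl (Eq.trans (∧-comm x b) b∧x≈⊥) ⟩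
    u ∨ ⊥         ≈⟨ ⊥-identityʳ u ⟩
    u             ∎

  ⊙-resp-≈ : ∀ {a b z z′} → z ≈ z′ → (a ⊙ b) z → (a ⊙ b) z′
  ⊙-resp-≈ z≈z′ (x , x∈b⁺ , z≈b∧[a∨x]) = x , x∈b⁺ , Eq.trans (Eq.sym z≈z′) z≈b∧[a∨x]

  ⊙-upperBound : ∀ {a b z} → (a ⊙ b) z → z ≤ b
  ⊙-upperBound (_ , _ , z≈b∧[a∨x]) = trans (reflexive z≈b∧[a∨x]) (x∧y≤x _ _)

  ⊙-lowerBound : ∀ {a b z} → (a ⊙ b) z → a ∧ b ≤ z
  ⊙-lowerBound {a} {b} (x , _ , z≈b∧[a∨x]) =
    trans (∧-greatest (x∧y≤y a b) (trans (x∧y≤x a b) (x≤x∨y a x))) (reflexive (Eq.sym z≈b∧[a∨x]))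

  ｛∧｝≤ˢ⊙ : ∀ a b → ｛ a ∧ b ｝ ≤ˢ (a ⊙ b)
  ｛∧｝≤ˢ⊙ _ _ _ _ (lift w≈a∧b) z∈a⊙b = trans (reflexive w≈a∧b) (⊙-lowerBound z∈a⊙b)

  ⊙≤ˢ｛｝ : ∀ a b → (a ⊙ b) ≤ˢ ｛ b ｝
  ⊙≤ˢ｛｝ _ _ _ _ z∈a⊙b (lift w≈b) = trans (⊙-upperBound z∈a⊙b) (reflexive (Eq.sym w≈b))

  ⊙-singleton : Complemented → ∀ {a b w} →
                (∀ x → IsComplementOf b x → b ∧ (a ∨ x) ≈ w) → (a ⊙ b) ≐ ｛ w ｝
  ⊙-singleton complemented {a} {b} {w} independent z =
    (λ { (x , lift x∈b⁺ , z≈b∧[a∨x]) → lift (Eq.trans z≈b∧[a∨x] (independent x x∈b⁺)) }) ,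
    (λ { (lift z≈w) → let (x , x∈b⁺) = complemented b
                      in x , lift x∈b⁺ , Eq.trans z≈w (Eq.sym (independent x x∈b⁺)) })

  ⊥⊙≐｛⊥｝ : Complemented → ∀ a → (⊥ ⊙ a) ≐ ｛ ⊥ ｝
  ⊥⊙≐｛⊥｝ complemented a = ⊙-singleton complemented λ x (_ , a∧x≈⊥) →
    Eq.trans (∧-cong Eq.refl (⊥-identityˡ x)) a∧x≈⊥

  ⊙⊥≐｛⊥｝ : Complemented → ∀ a → (a ⊙ ⊥) ≐ ｛ ⊥ ｝
  ⊙⊥≐｛⊥｝ complemented a = ⊙-singleton complemented λ x _ → ∧-zeroˡ (a ∨ x)

  ⊙⊤≐｛｝ : Complemented → ∀ a → (a ⊙ ⊤) ≐ ｛ a ｝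
  ⊙⊤≐｛｝ complemented a = ⊙-singleton complemented λ x x∈⊤⁺ → begin
    ⊤ ∧ (a ∨ x)  ≈⟨ ⊤-identityˡ (a ∨ x) ⟩
    a ∨ x        ≈⟨ ∨-cong Eq.refl (complement-of-⊤ x∈⊤⁺) ⟩
    a ∨ ⊥        ≈⟨ ⊥-identityʳ a ⟩
    a            ∎

  ⊙-mono-≤₁ : ∀ {a a′ b} → a ≤ a′ → (a ⊙ b) ≤₁ (a′ ⊙ b)
  ⊙-mono-≤₁ {a′ = a′} {b} a≤a′ z (x , x∈b⁺ , z≈b∧[a∨x]) =
    b ∧ (a′ ∨ x) , (x , x∈b⁺ , Eq.refl) ,
    trans (reflexive z≈b∧[a∨x]) (∧-monotonic refl (∨-monotonic a≤a′ refl))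

  ⊙-mono-≤₂ : ∀ {a a′ b} → a ≤ a′ → (a ⊙ b) ≤₂ (a′ ⊙ b)
  ⊙-mono-≤₂ {a} {b = b} a≤a′ z (x , x∈b⁺ , z≈b∧[a′∨x]) =
    b ∧ (a ∨ x) , (x , x∈b⁺ , Eq.refl) ,
    trans (∧-monotonic refl (∨-monotonic a≤a′ refl)) (reflexive (Eq.sym z≈b∧[a′∨x]))

  ⊙-below : Complemented → ∀ {a b} → b ≤ a → (a ⊙ b) ≐ ｛ b ｝
  ⊙-below complemented {a} b≤a =
    ⊙-singleton complemented λ x _ → x≤y⇒x∧y≈x (trans b≤a (x≤x∨y a x))

  ⊙-above : Complemented → Modular → ∀ {a b} → a ≤ b → (a ⊙ b) ≐ ｛ a ｝
  ⊙-above complemented modular a≤b =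
    ⊙-singleton complemented λ _ x∈b⁺ → modular-complement-cancel modular a≤b x∈b⁺

  ⊙≐｛self｝⇒≤ : ∀ {a b} → (a ⊙ b) ≐ ｛ a ｝ → a ≤ b
  ⊙≐｛self｝⇒≤ {a} a⊙b≐｛a｝ = ⊙-upperBound (proj₂ (a⊙b≐｛a｝ a) (lift Eq.refl))

  ⊙ˢ｛｝≐⋃⊙ : ∀ (A : Subset) b → (A ⊙ˢ ｛ b ｝) ≐ (λ z → ∃[ u ] (A u × (u ⊙ b) z))
  ⊙ˢ｛｝≐⋃⊙ A b z = to , from
    where
    to : (A ⊙ˢ ｛ b ｝) z → ∃[ u ] (A u × (u ⊙ b) z)
    to (y , w , lift y≈b , (u , x , u∈A , x∈｛b｝⁺ , w≈u∨x) , z≈y∧w) =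
      u , u∈A , x , lift (x∈｛b｝⁺ b (lift Eq.refl)) , Eq.trans z≈y∧w (∧-cong y≈b w≈u∨x)
    from : ∃[ u ] (A u × (u ⊙ b) z) → (A ⊙ˢ ｛ b ｝) z
    from (u , u∈A , x , lift x∈b⁺ , z≈b∧[u∨x]) =
      b , u ∨ x , lift Eq.refl , (u , x , u∈A , complement⇒｛｝⁺ˢ x∈b⁺ , Eq.refl) , z≈b∧[u∨x]

  ⊙-idempotent : Complemented → Modular → ∀ a b → ((a ⊙ b) ⊙ˢ ｛ b ｝) ≐ (a ⊙ b)
  ⊙-idempotent complemented modular a b z =
    (λ h → let (u , u∈a⊙b , z∈u⊙b) = proj₁ (⊙ˢ｛｝≐⋃⊙ (a ⊙ b) b z) h
               z≈u = lower (proj₁ (fixes u∈a⊙b z) z∈u⊙b)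
           in ⊙-resp-≈ (Eq.sym z≈u) u∈a⊙b) ,
    (λ z∈a⊙b → proj₂ (⊙ˢ｛｝≐⋃⊙ (a ⊙ b) b z)
                  (z , z∈a⊙b , proj₂ (fixes z∈a⊙b z) (lift Eq.refl)))
    where
    fixes : ∀ {u} → (a ⊙ b) u → (u ⊙ b) ≐ ｛ u ｝
    fixes u∈a⊙b = ⊙-above complemented modular (⊙-upperBound u∈a⊙b)

proposition4p1 : {ℓc ℓ₁ ℓ₂ : Level} (L : BoundedLattice ℓc ℓ₁ ℓ₂) →
    let open BoundedLattice L
        open Ops L
    in NonTrivial → Complemented →
    (a b c : Carrier) →
      -- (i)  0 ⊙ a = a ⊙ 0 = {0}
      (((⊥ ⊙ a) ≐ ｛ ⊥ ｝) × ((a ⊙ ⊥) ≐ ｛ ⊥ ｝))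
    × -- (ii)  1 ⊙ a = a ⊙ 1 = {a}
      (((⊤ ⊙ a) ≐ ｛ a ｝) × ((a ⊙ ⊤) ≐ ｛ a ｝))
    × -- (iii)  a ∧ b ≤ a ⊙ b ≤ b, and b ≤ a → a ⊙ b = {b}
      ((｛ a ∧ b ｝ ≤ˢ (a ⊙ b)) × ((a ⊙ b) ≤ˢ ｛ b ｝)
        × (b ≤ a → (a ⊙ b) ≐ ｛ b ｝))
    × -- (iv)  a ≤ b → a ⊙ c ≤₁ b ⊙ c and a ⊙ c ≤₂ b ⊙ c
      (a ≤ b → ((a ⊙ c) ≤₁ (b ⊙ c)) × ((a ⊙ c) ≤₂ (b ⊙ c)))
    × -- (v)  modular ⇒ (a ≤ b ⇔ a ⊙ b = {a}) and (a ⊙ b) ⊙ b = a ⊙ b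
      (Modular →
        (a ≤ b ⇔ ((a ⊙ b) ≐ ｛ a ｝))
        × (((a ⊙ b) ⊙ˢ ｛ b ｝) ≐ (a ⊙ b)))
proposition4p1 L _ complemented a b c =
  (⊥⊙≐｛⊥｝ complemented a , ⊙⊥≐｛⊥｝ complemented a) ,
  (⊙-below complemented (maximum a) , ⊙⊤≐｛｝ complemented a) ,
  (｛∧｝≤ˢ⊙ a b , ⊙≤ˢ｛｝ a b , ⊙-below complemented) ,
  (λ a≤b → ⊙-mono-≤₁ a≤b , ⊙-mono-≤₂ a≤b) ,
  λ modular → mk⇔ (⊙-above complemented modular) ⊙≐｛self｝⇒≤ ,
              ⊙-idempotent complemented modular a b
  where
  open BoundedLattice L
  open Ops L
  open ComplementedLatticeProperties L
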